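{- For each $k\in\{2,3,4\}$, there are infinitely many pairwise non-isomorphic graphs $G\in\mathcal{M}(\mathcal{C})$ with chromatic number $\chi(G)=k$.
   Context: All graphs are finite and simple. $\mathcal{R}(\mathcal{C})$ is the class of graphs $G$ such that every $2$-colouring of the edges of $G$ admits a monochromatic cycle (of any length). $\mathcal{M}(\mathcal{C})$ is the class of graphs in $\mathcal{R}(\mathcal{C})$ no proper subgraph of which is in $\mathcal{R}(\mathcal{C})$. -}

module Defs where

open import Data.Nat using (ℕ; zero; suc; _≤_)
open import Data.Fin using (Fin; zero; suc; inject₁; fromℕ)
open import Data.Bool using (Bool; true; false)
open import Data.Product using (Σ; ∃; _×_; _,_)
open import Relation.Binary.PropositionalEquality using (_≡_; _≢_)
open import Relation.Nullary using (¬_)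
open import Function.Definitions using (Injective; Surjective)
open import Function.Bundles using (_↔_; Inverse)

record Graph : Set where
  field
    V     : ℕ
    E     : Fin V → Fin V → Bool
    sym   : ∀ i j → E i j ≡ E j i
    irrefl : ∀ i → E i i ≡ false
open Graph public

Adj : (G : Graph) → Fin (V G) → Fin (V G) → Set
Adj G i j = E G i j ≡ true

-- A 2-colouring of the edges of G: a colour for each (unordered) pair,
-- symmetric so that each edge {i,j} gets a single colour.
-- (Values on non-adjacent pairs are irrelevant.)
record EdgeColouring (G : Graph) : Set where
  field
    col    : Fin (V G) → Fin (V G) → Bool
    colSym : ∀ i j → col i j ≡ col j i
open EdgeColouring public

record MonoCycle (G : Graph) (c : EdgeColouring G) : Set where
  field
    len-3  : ℕ
    w      : Fin (suc (suc (suc len-3))) → Fin (V G)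
    w-inj  : Injective _≡_ _≡_ w
    colour : Bool
    step   : ∀ (i : Fin (suc (suc len-3))) →
             Adj G (w (inject₁ i)) (w (suc i)) ×
             col c (w (inject₁ i)) (w (suc i)) ≡ colour
    close  : Adj G (w (fromℕ (suc (suc len-3)))) (w zero) ×
             col c (w (fromℕ (suc (suc len-3)))) (w zero) ≡ colour

InRC : Graph → Set
InRC G = (c : EdgeColouring G) → MonoCycle G c

-- H is a proper subgraph of G: H embeds into G via an injective vertex map f
-- preserving adjacency (so H is, up to relabelling, obtained from G by deleting
-- vertices and edges), and H is not all of G (f is not surjective, or some edge
-- of G among the image vertices is missing from H).
record ProperSubgraph (H G : Graph) : Set where
  field
    f        : Fin (V H) → Fin (V G)
    f-inj    : Injective _≡_ _≡_ f
    f-adj    : ∀ i j → Adj H i j → Adj G (f i) (f j)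
    proper   : ¬ (Surjective _≡_ _≡_ f × (∀ i j → Adj G (f i) (f j) → Adj H i j))

InMC : Graph → Set
InMC G = InRC G × (∀ H → ProperSubgraph H G → ¬ InRC H)

Colourable : Graph → ℕ → Set
Colourable G k = Σ (Fin (V G) → Fin k) λ c → ∀ i j → Adj G i j → c i ≢ c j

ChromaticNumber : Graph → ℕ → Set
ChromaticNumber G k = Colourable G k × (∀ j → Colourable G j → k ≤ j)

record Iso (G H : Graph) : Set where
  field
    bij     : Fin (V G) ↔ Fin (V H)
    adj-iff : ∀ i j → E G i j ≡ E H (Inverse.to bij i) (Inverse.to bij j)

-- A graph lies in R(C) exactly when its edges cannot be split into two forests. A forest is
-- recorded by a parent map along whose edges a rank strictly decreases: such a colour class has no
-- cycle (look at a vertex of maximal rank), and peeling off vertices of degree at most one shows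
-- that every acyclic colour class has this form. Coding each edge by its colour and its child
-- endpoint shows that two forests on n vertices have at most 2n − 2 edges, so a graph with 2n − 1
-- edges is in R(C). It is even in M(C) if it has no isolated vertex and G − e splits into two
-- forests for every edge e, because a proper subgraph misses some edge. Both properties survive
-- the 1-extension, which deletes an edge ab and adds a vertex adjacent to a, b and z: the new vertex
-- is a leaf in one forest and, in the other, a leaf or the midpoint of ab. Starting from K₅ − e and
-- two of its 1-extensions (χ = 4, 3, 2), a double 1-extension that keeps a k-clique and a proper
-- k-colouring is iterated; the vertex counts grow by 2 each time.

module Submission where

open import Defs hiding (sym)
open import Data.Nat using (ℕ; zero; suc; _+_; _*_; _≤_; _<_; _<?_; s≤s) renaming (_≟_ to _≟ℕ_)
open import Data.Nat.Properties
  using (<⇒≱; m≢1+n+m; ≤-trans; ≤-pred; +-suc; +-identityʳ; n≤1+n; n<1+n; 1+n≰n; *-suc; *-monoʳ-≤; *-monoʳ-<;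
         *-cancelˡ-≡; +-cancelʳ-≡)
open import Data.Bool using (Bool; true; false; _∧_; _∨_; not)
open import Data.Bool.Properties using (∨-comm; ∧-conicalˡ; ∧-conicalʳ; not-injective; not-involutive) renaming (_≟_ to _≟ᵇ_)
open import Data.Fin using (Fin; zero; suc; #_; inject₁; fromℕ; fromℕ<; toℕ; _≟_; _↑ˡ_; _↑ʳ_; splitAt)
open import Data.Fin.Properties
  using (toℕ-inject₁; suc-injective; cantor-schröder-bernstein; splitAt-↑ˡ; splitAt-↑ʳ; toℕ-fromℕ; toℕ-fromℕ<;
         toℕ<n; toℕ-injective; injective⇒≤; all?; any?; ¬∀⟶∃¬)
open import Data.Fin.Subset using (Subset; _∈_; _-_; _⊂_; ⊤)
open import Data.Fin.Subset.Properties using (_∈?_; nonempty?; ∈⊤; x∈p∧x≢y⇒x∈p-y; x∈p⇒p-x⊂p)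
open import Data.Fin.Subset.Induction using (Acc; acc; ⊂-wellFounded)
open import Data.Vec using (Vec; []; _∷_; lookup)
open import Data.Vec.Functional using (updateAt)
open import Data.Vec.Functional.Properties using (updateAt-updates; updateAt-minimal)
open import Data.Fin.Relation.Unary.Top using (view; ‵fromℕ; ‵inject₁)
open import Data.List using (allFin)
open import Data.List.Extrema.Nat using (argmax; f[xs]≤f[argmax]; argmin; f[argmin]≤f[xs])
open import Data.List.Membership.Propositional.Properties using (∈-allFin)
import Data.List.Relation.Unary.All as All
open import Data.Product using (Σ; ∃; ∃₂; _×_; _,_; proj₁; proj₂; uncurry)
open import Data.Sum using (_⊎_; inj₁; inj₂; [_,_])
open import Data.Empty using (⊥; ⊥-elim)
open import Relation.Binary.PropositionalEquality using (_≡_; _≢_; refl; sym; trans; cong; cong₂; subst; subst₂)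
open import Function.Bundles using (mk⇔; Injection)
import Function.Properties.Inverse as ↔
open import Relation.Nullary using (¬_; Dec; yes; no; does)
open import Relation.Nullary.Decidable
  using (True; toWitness; from-yes; _×-dec_; _⊎-dec_; _→-dec_; ¬?; map′; decidable-stable; does-⇔; dec-true; dec-false)
open import Function using (_∘_)
open import Function.Definitions using (Injective)

data SameEdge {n : ℕ} : Fin n → Fin n → Fin n → Fin n → Set where
  same    : ∀ {i j} → SameEdge i j i j
  swapped : ∀ {i j} → SameEdge i j j i

endpoints : ∀ {n} {i j x y : Fin n} → SameEdge i j x y → (i ≡ x × j ≡ y) ⊎ (i ≡ y × j ≡ x)
endpoints same = inj₁ (refl , refl)
endpoints swapped = inj₂ (refl , refl)

same-edge? : ∀ {n} (i j x y : Fin n) → Dec (SameEdge i j x y)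
same-edge? i j x y = map′ from-sum endpoints (((i ≟ x) ×-dec (j ≟ y)) ⊎-dec ((i ≟ y) ×-dec (j ≟ x)))
  where
  from-sum : (i ≡ x × j ≡ y) ⊎ (i ≡ y × j ≡ x) → SameEdge i j x y
  from-sum (inj₁ (refl , refl)) = same
  from-sum (inj₂ (refl , refl)) = swapped

SameEdge-sym : ∀ {n} {i j x y : Fin n} → SameEdge i j x y → SameEdge x y i j
SameEdge-sym same = same
SameEdge-sym swapped = swapped

SameEdge-flip : ∀ {n} {i j x y : Fin n} → SameEdge i j x y → SameEdge j i x y
SameEdge-flip same = swapped
SameEdge-flip swapped = same

SameEdge-trans : ∀ {n} {i j x y u v : Fin n} → SameEdge i j x y → SameEdge x y u v → SameEdge i j u v
SameEdge-trans same same = same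
SameEdge-trans same swapped = swapped
SameEdge-trans swapped same = swapped
SameEdge-trans swapped swapped = same

SameEdge-injective : ∀ {m n} {f : Fin m → Fin n} → Injective _≡_ _≡_ f →
                     ∀ {i j x y} → SameEdge (f i) (f j) (f x) (f y) → SameEdge i j x y
SameEdge-injective f-inj e with endpoints e
... | inj₁ (ix , jy) rewrite f-inj ix | f-inj jy = same
... | inj₂ (iy , jx) rewrite f-inj iy | f-inj jx = swapped

SameEdge-map : ∀ {m n} (f : Fin m → Fin n) {i j x y} → SameEdge i j x y → SameEdge (f i) (f j) (f x) (f y)
SameEdge-map f same = same
SameEdge-map f swapped = swapped

SameEdge-endpoint : ∀ {n} {i j x y k : Fin n} → SameEdge i j x y → k ≡ x ⊎ k ≡ y → k ≡ i ⊎ k ≡ j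
SameEdge-endpoint same k∈xy = k∈xy
SameEdge-endpoint swapped (inj₁ k≡j) = inj₂ k≡j
SameEdge-endpoint swapped (inj₂ k≡i) = inj₁ k≡i

_≈_ : ∀ {n} → Fin n × Fin n → Fin n × Fin n → Set
(i , j) ≈ (x , y) = SameEdge i j x y

_≈?_ : ∀ {n} (e f : Fin n × Fin n) → Dec (e ≈ f)
(i , j) ≈? (x , y) = same-edge? i j x y

does-true⇒ : ∀ {A : Set} (a? : Dec A) → does a? ≡ true → A
does-true⇒ (yes a) _ = a
does-true⇒ (no _) ()

does-false⇒¬ : ∀ {A : Set} (a? : Dec A) → does a? ≡ false → ¬ A
does-false⇒¬ (yes _) ()
does-false⇒¬ (no ¬a) _ = ¬a

adj? : (G : Graph) (i j : Fin (V G)) → Dec (Adj G i j)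
adj? G i j = E G i j ≟ᵇ true

adj⇒≢ : ∀ (H : Graph) {i j} → Adj H i j → i ≢ j
adj⇒≢ H {i} ii refl with trans (sym ii) (irrefl H i)
... | ()

NoIsolatedVertex : Graph → Set
NoIsolatedVertex G = ∀ u → ∃ (Adj G u)

-- Forests as parent maps with decreasing ranks

data Oriented {n : ℕ} (p : Fin n → Fin n) (r : Fin n → ℕ) (i j : Fin n) : Set where
  to-parent   : p i ≡ j → r j < r i → Oriented p r i j
  from-child  : p j ≡ i → r i < r j → Oriented p r i j

Oriented-sym : ∀ {n} {p : Fin n → Fin n} {r i j} → Oriented p r i j → Oriented p r j i
Oriented-sym (to-parent e lt) = from-child e lt
Oriented-sym (from-child e lt) = to-parent e lt

Oriented-local : ∀ {n} {p p′ : Fin n → Fin n} {r r′ : Fin n → ℕ} {u v} →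
                 p u ≡ p′ u → p v ≡ p′ v → r u ≡ r′ u → r v ≡ r′ v → Oriented p r u v → Oriented p′ r′ u v
Oriented-local pu pv ru rv (to-parent e lt) = to-parent (trans (sym pu) e) (subst₂ _<_ rv ru lt)
Oriented-local pu pv ru rv (from-child e lt) = from-child (trans (sym pv) e) (subst₂ _<_ ru rv lt)

maximiser : ∀ {n} → Fin n → (f : Fin n → ℕ) → ∃ λ t → ∀ x → f x ≤ f t
maximiser {n} x₀ f =
  argmax f x₀ (allFin n) , λ x → All.lookup (f[xs]≤f[argmax] {f = f} x₀ (allFin n)) (∈-allFin x)

minimiser : ∀ {n} → Fin n → (f : Fin n → ℕ) → ∃ λ t → ∀ x → f t ≤ f x
minimiser {n} x₀ f =
  argmin f x₀ (allFin n) , λ x → All.lookup (f[argmin]≤f[xs] {f = f} x₀ (allFin n)) (∈-allFin x)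

parent-of-higher : ∀ {n} {p : Fin n → Fin n} {r : Fin n → ℕ} {t u} →
                   Oriented p r t u → r u ≤ r t → p t ≡ u
parent-of-higher (to-parent e _) _ = e
parent-of-higher (from-child _ t<u) u≤t = ⊥-elim (<⇒≱ t<u u≤t)

-- A vertex of maximal rank on the cycle would have both of its cycle neighbours as parent.
no-oriented-cycle : ∀ {n m} (p : Fin n → Fin n) (r : Fin n → ℕ)
                    (w : Fin (suc (suc (suc m))) → Fin n) → Injective _≡_ _≡_ w →
                    (∀ i → Oriented p r (w (inject₁ i)) (w (suc i))) →
                    Oriented p r (w (fromℕ (suc (suc m)))) (w zero) → ⊥
no-oriented-cycle p r w w-inj step close =
  let t , top = maximiser zero (λ i → r (w i))
      u , v , u≢v , tu , tv = neighbours t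
  in u≢v (w-inj (trans (sym (parent-of-higher tu (top u))) (parent-of-higher tv (top v))))
  where
  neighbours : ∀ t → ∃₂ λ u v → u ≢ v × Oriented p r (w t) (w u) × Oriented p r (w t) (w v)
  neighbours zero = suc zero , fromℕ _ , (λ ()) , step zero , Oriented-sym close
  neighbours (suc t) with view t
  ... | ‵fromℕ = zero , inject₁ (fromℕ _) , (λ ()) , close , Oriented-sym (step (fromℕ _))
  ... | ‵inject₁ j =
    suc (suc j) , inject₁ (inject₁ j) , two-apart , step (suc j) , Oriented-sym (step (inject₁ j))
    where
    two-apart : suc (suc j) ≢ inject₁ (inject₁ j)
    two-apart e =
      m≢1+n+m (toℕ j) (sym (trans (cong toℕ e) (trans (toℕ-inject₁ (inject₁ j)) (toℕ-inject₁ j))))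

module _ {n : ℕ} {p : Fin n → Fin n} {r : Fin n → ℕ} where

  child : ∀ {i j} → Oriented p r i j → Fin n
  child {i} (to-parent _ _) = i
  child {j = j} (from-child _ _) = j

  child-edge : ∀ {i j} (o : Oriented p r i j) → SameEdge (child o) (p (child o)) i j
  child-edge (to-parent refl _) = same
  child-edge (from-child refl _) = swapped

  child-above-parent : ∀ {i j} (o : Oriented p r i j) → r (p (child o)) < r (child o)
  child-above-parent (to-parent refl lt) = lt
  child-above-parent (from-child refl lt) = lt

oriented? : ∀ {n} (p : Fin n → Fin n) (r : Fin n → ℕ) i j → Dec (Oriented p r i j)
oriented? p r i j = map′ [ uncurry to-parent , uncurry from-child ] split
                         (((p i ≟ j) ×-dec (r j <? r i)) ⊎-dec ((p j ≟ i) ×-dec (r i <? r j)))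
  where
  split : Oriented p r i j → _
  split (to-parent e lt) = inj₁ (e , lt)
  split (from-child e lt) = inj₂ (e , lt)

record TwoForests (G : Graph) (x y : Fin (V G)) : Set where
  field
    colouring : EdgeColouring G
    parent    : Bool → Fin (V G) → Fin (V G)
    rank      : Bool → Fin (V G) → ℕ
    oriented  : ∀ {i j} → Adj G i j → ¬ SameEdge i j x y →
                Oriented (parent (col colouring i j)) (rank (col colouring i j)) i j

TwoForests-respects : ∀ {G x y u v} → SameEdge x y u v → TwoForests G u v → TwoForests G x y
TwoForests-respects xy≈uv F = record
  { colouring = colouring ; parent = parent ; rank = rank
  ; oriented = λ ij ¬xy → oriented ij (λ ij≈uv → ¬xy (SameEdge-trans ij≈uv (SameEdge-sym xy≈uv))) }
  where open TwoForests F

swap-colours : ∀ {G x y} → TwoForests G x y → TwoForests G x y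
swap-colours F = record
  { colouring = record { col = λ i j → not (col colouring i j)
                       ; colSym = λ i j → cong not (colSym colouring i j) }
  ; parent = parent ∘ not
  ; rank = rank ∘ not
  ; oriented = λ {i} {j} ij ¬xy →
      subst (λ γ → Oriented (parent γ) (rank γ) i j) (sym (not-involutive _)) (oriented ij ¬xy)
  }
  where open TwoForests F

pullback : ∀ {H G : Graph} → (Fin (V H) → Fin (V G)) → EdgeColouring G → EdgeColouring H
pullback f c = record { col = λ i j → col c (f i) (f j) ; colSym = λ i j → colSym c (f i) (f j) }

no-monoCycle-in-forests : ∀ {n} (H : Graph) (c : EdgeColouring H) (g : Fin (V H) → Fin n) →
                          Injective _≡_ _≡_ g → (p : Bool → Fin n → Fin n) (r : Bool → Fin n → ℕ) →
                          (∀ {i j} → Adj H i j → Oriented (p (col c i j)) (r (col c i j)) (g i) (g j)) →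
                          ¬ MonoCycle H c
no-monoCycle-in-forests H c g g-inj p r oriented cyc =
  no-oriented-cycle (p colour) (r colour) (g ∘ w) (w-inj ∘ g-inj)
    (λ i → monochromatic (step i)) (monochromatic close)
  where
  open MonoCycle cyc
  monochromatic : ∀ {u v} → Adj H u v × col c u v ≡ colour → Oriented (p colour) (r colour) (g u) (g v)
  monochromatic (uv , refl) = oriented uv

module _ {H G : Graph} (S : ProperSubgraph H G) where
  open ProperSubgraph S

  MissedEdge : Set
  MissedEdge = ∃₂ λ x y → Adj G x y × (∀ {i j} → Adj H i j → ¬ SameEdge (f i) (f j) x y)

  missed-edge-at-missed-vertex : NoIsolatedVertex G → ∀ u → (∀ i → f i ≢ u) → MissedEdge
  missed-edge-at-missed-vertex no-isolated u u∉f =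
    u , no-isolated u .proj₁ , no-isolated u .proj₂ ,
    λ {i} {j} _ e → [ (λ (iu , _) → u∉f i iu) , (λ (_ , ju) → u∉f j ju) ] (endpoints e)

  missed-edge-of-image : ∀ i j → Adj G (f i) (f j) → ¬ Adj H i j → MissedEdge
  missed-edge-of-image i j fij ¬ij = f i , f j , fij , misses
    where
    misses : ∀ {i′ j′} → Adj H i′ j′ → ¬ SameEdge (f i′) (f j′) (f i) (f j)
    misses a e with SameEdge-injective f-inj e
    ... | same = ¬ij a
    ... | swapped = ¬ij (trans (Graph.sym H _ _) a)

  missed-edge : NoIsolatedVertex G → MissedEdge
  missed-edge no-isolated with all? (λ y → any? (λ x → f x ≟ y))
  ... | no not-onto =
    let u , u∉f = ¬∀⟶∃¬ _ _ (λ y → any? (λ x → f x ≟ y)) not-onto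
    in missed-edge-at-missed-vertex no-isolated u (λ i fi≡u → u∉f (i , fi≡u))
  ... | yes onto with all? (λ i → all? (λ j → adj? G (f i) (f j) →-dec adj? H i j))
  ...   | yes full = ⊥-elim (proper ((λ y → onto y .proj₁ , λ { refl → onto y .proj₂ }) , full))
  ...   | no not-full =
    let i , ¬i = ¬∀⟶∃¬ _ _ (λ i → all? (λ j → adj? G (f i) (f j) →-dec adj? H i j)) not-full
        j , ¬ij = ¬∀⟶∃¬ _ _ (λ j → adj? G (f i) (f j) →-dec adj? H i j) ¬i
    in missed-edge-of-image i j (decidable-stable (adj? G (f i) (f j)) (λ ¬a → ¬ij (⊥-elim ∘ ¬a)))
                              (λ a → ¬ij (λ _ → a))

proper-subgraphs-not-in-RC : ∀ {G} → (∀ {x y} → Adj G x y → TwoForests G x y) → NoIsolatedVertex G →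
                             ∀ H → ProperSubgraph H G → ¬ InRC H
proper-subgraphs-not-in-RC split no-isolated H S rc =
  let x , y , xy , misses = missed-edge S no-isolated
      open TwoForests (split xy)
      c = pullback f colouring
  in no-monoCycle-in-forests H c f f-inj parent rank (λ {i} {j} a → oriented (f-adj i j a) (misses a)) (rc c)
  where open ProperSubgraph S

-- A colour class without cycles is a forest

module ColourClass (G : Graph) (c : EdgeColouring G) (β : Bool) where

  _~_ : Fin (V G) → Fin (V G) → Set
  u ~ v = Adj G u v × col c u v ≡ β

  _~?_ : ∀ u v → Dec (u ~ v)
  u ~? v = adj? G u v ×-dec (col c u v ≟ᵇ β)

  ~-sym : ∀ {u v} → u ~ v → v ~ u
  ~-sym (uv , cuv) = trans (Graph.sym G _ _) uv , trans (colSym c _ _) cuv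

  ~-irrefl : ∀ {u v} → u ~ v → u ≢ v
  ~-irrefl = adj⇒≢ G ∘ proj₁

  record Path (k : ℕ) : Set where
    field
      vertex    : ℕ → Fin (V G)
      injective : ∀ {i j} → i ≤ k → j ≤ k → vertex i ≡ vertex j → i ≡ j
      adjacent  : ∀ {i} → i < k → vertex i ~ vertex (suc i)
  open Path

  path-length : ∀ {k} → Path k → suc k ≤ V G
  path-length P = injective⇒≤ {f = λ (i : Fin _) → vertex P (toℕ i)}
    (λ {i} {j} e → toℕ-injective (injective P (≤-pred (toℕ<n i)) (≤-pred (toℕ<n j)) e))

  cycle-from-chord : ∀ {k} (P : Path k) m → suc (suc m) ≤ k →
                     vertex P 0 ~ vertex P (suc (suc m)) → MonoCycle G c
  cycle-from-chord {k} P m m+2≤k chord = record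
    { len-3 = m
    ; w = λ i → vertex P (toℕ i)
    ; w-inj = λ {i} {j} e → toℕ-injective (injective P (on-path i) (on-path j) e)
    ; colour = β
    ; step = λ i → subst (λ t → vertex P t ~ vertex P (suc (toℕ i))) (sym (toℕ-inject₁ i))
                     (adjacent P (≤-trans (toℕ<n i) m+2≤k))
    ; close = subst (λ t → vertex P t ~ vertex P 0) (sym (toℕ-fromℕ _)) (~-sym chord)
    }
    where
    on-path : (i : Fin (suc (suc (suc m)))) → toℕ i ≤ k
    on-path i = ≤-trans (≤-pred (toℕ<n i)) m+2≤k

  cycle-from-neighbour-on-path : ∀ {k} (P : Path k) i → i ≤ k → vertex P 0 ~ vertex P i → i ≢ 1 → MonoCycle G c
  cycle-from-neighbour-on-path P zero _ loop _ = ⊥-elim (~-irrefl loop refl)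
  cycle-from-neighbour-on-path P (suc zero) _ _ i≢1 = ⊥-elim (i≢1 refl)
  cycle-from-neighbour-on-path P (suc (suc m)) i≤k chord _ = cycle-from-chord P m i≤k chord

  prepend : ∀ {k} (P : Path k) x → x ~ vertex P 0 → (∀ i → i ≤ k → vertex P i ≢ x) → Path (suc k)
  prepend {k} P x x~ x∉P = record { vertex = vertex′ ; injective = injective′ ; adjacent = adjacent′ }
    where
    vertex′ : ℕ → Fin (V G)
    vertex′ zero = x
    vertex′ (suc i) = vertex P i
    injective′ : ∀ {i j} → i ≤ suc k → j ≤ suc k → vertex′ i ≡ vertex′ j → i ≡ j
    injective′ {zero} {zero} _ _ _ = refl
    injective′ {zero} {suc j} _ (s≤s j≤k) e = ⊥-elim (x∉P j j≤k (sym e))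
    injective′ {suc i} {zero} (s≤s i≤k) _ e = ⊥-elim (x∉P i i≤k e)
    injective′ {suc i} {suc j} (s≤s i≤k) (s≤s j≤k) e = cong suc (injective P i≤k j≤k e)
    adjacent′ : ∀ {i} → i < suc k → vertex′ i ~ vertex′ (suc i)
    adjacent′ {zero} _ = x~
    adjacent′ {suc i} (s≤s i<k) = adjacent P i<k

  Neighbour : Subset (V G) → Fin (V G) → Fin (V G) → Set
  Neighbour S v u = u ∈ S × v ~ u

  neighbour? : ∀ S v u → Dec (Neighbour S v u)
  neighbour? S v u = (u ∈? S) ×-dec (v ~? u)

  TwoNeighbours : Subset (V G) → Fin (V G) → Set
  TwoNeighbours S v = ∃₂ λ u₁ u₂ → u₁ ≢ u₂ × Neighbour S v u₁ × Neighbour S v u₂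

  two-neighbours? : ∀ S v → Dec (TwoNeighbours S v)
  two-neighbours? S v = any? λ u₁ → any? λ u₂ →
    ¬? (u₁ ≟ u₂) ×-dec (neighbour? S v u₁ ×-dec neighbour? S v u₂)

  module _ (S : Subset (V G)) (two : ∀ {v} → v ∈ S → TwoNeighbours S v) where

    neighbour-on-path : ∀ {k} (P : Path k) →
                        ¬ ∃ (λ x → Neighbour S (vertex P 0) x × ∀ (i : Fin (suc k)) → vertex P (toℕ i) ≢ x) →
                        ∀ {u} → Neighbour S (vertex P 0) u → ∃ λ i → i ≤ k × vertex P i ≡ u
    neighbour-on-path P all-on-path {u} nb =
      let i , ¬≢ = ¬∀⟶∃¬ _ _ (λ i → ¬? (vertex P (toℕ i) ≟ u)) (λ off → all-on-path (u , nb , off))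
      in toℕ i , ≤-pred (toℕ<n i) , decidable-stable (vertex P (toℕ i) ≟ u) ¬≢

    -- Grow a path at its head until both neighbours of the head lie on it; the one farther along
    -- closes a cycle. The fuel f counts the vertices not on the path.
    grow : ∀ f {k} → k + f ≡ V G → (P : Path k) → vertex P 0 ∈ S → MonoCycle G c
    grow f {k} k+f≡n P head∈S
      with u₁ , u₂ , u₁≢u₂ , (u₁∈S , h~u₁) , (u₂∈S , h~u₂) ← two head∈S
      with any? (λ x → neighbour? S (vertex P 0) x ×-dec
                       all? (λ (i : Fin (suc k)) → ¬? (vertex P (toℕ i) ≟ x)))
    ... | yes (x , (x∈S , h~x) , x∉P) = grow-with f k+f≡n (prepend P x (~-sym h~x) x∉P′) x∈S
      where
      x∉P′ : ∀ i → i ≤ k → vertex P i ≢ x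
      x∉P′ i i≤k e =
        x∉P (fromℕ< (s≤s i≤k)) (subst (λ t → vertex P t ≡ x) (sym (toℕ-fromℕ< (s≤s i≤k))) e)
      grow-with : ∀ f → k + f ≡ V G → (P′ : Path (suc k)) → vertex P′ 0 ∈ S → MonoCycle G c
      grow-with zero k≡n P′ _ =
        ⊥-elim (1+n≰n (≤-trans (n≤1+n _)
          (subst (suc (suc k) ≤_) (trans (sym k≡n) (+-identityʳ k)) (path-length P′))))
      grow-with (suc f) k+f≡n P′ h∈S = grow f (trans (sym (+-suc k f)) k+f≡n) P′ h∈S
    ... | no all-on-path
      with i₁ , i₁≤k , refl ← neighbour-on-path P all-on-path (u₁∈S , h~u₁)
      with i₂ , i₂≤k , refl ← neighbour-on-path P all-on-path (u₂∈S , h~u₂)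
      with i₁ ≟ℕ 1
    ... | no i₁≢1 = cycle-from-neighbour-on-path P i₁ i₁≤k h~u₁ i₁≢1
    ... | yes refl = cycle-from-neighbour-on-path P i₂ i₂≤k h~u₂ (λ { refl → u₁≢u₂ refl })

    cycle-if-two-neighbours : ∀ {s} → s ∈ S → MonoCycle G c
    cycle-if-two-neighbours {s} s∈S = grow (V G) refl trivial s∈S
      where
      trivial : Path 0
      trivial = record { vertex = λ _ → s ; injective = λ { {zero} {zero} _ _ _ → refl } ; adjacent = λ () }

  Forest : Subset (V G) → Set
  Forest S = Σ (Fin (V G) → Fin (V G)) λ p → Σ (Fin (V G) → ℕ) λ r →
               ∀ {u v} → u ∈ S → v ∈ S → u ~ v → Oriented p r u v

  -- When v has no neighbour in S, u is arbitrary (v itself is used).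
  attach : ∀ {S v} u → v ∈ S → (∀ {w} → Neighbour S v w → w ≡ u) → Forest (S - v) → Forest S
  attach {S} {v} u v∈S unique (p , r , oriented) = p′ , r′ , oriented′
    where
    p′ = updateAt p v (λ _ → u)
    r′ = updateAt r v (λ _ → suc (r u))
    towards-u : ∀ {w} → w ∈ S → v ~ w → Oriented p′ r′ v w
    towards-u w∈S v~w with refl ← unique (w∈S , v~w) =
      to-parent (updateAt-updates v p)
        (subst₂ _<_ (sym (updateAt-minimal _ v r (~-irrefl (~-sym v~w)))) (sym (updateAt-updates v r)) (n<1+n _))
    oriented′ : ∀ {w w′} → w ∈ S → w′ ∈ S → w ~ w′ → Oriented p′ r′ w w′
    oriented′ {w} {w′} w∈S w′∈S w~w′ with w ≟ v | w′ ≟ v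
    ... | yes refl | yes refl = ⊥-elim (~-irrefl w~w′ refl)
    ... | yes refl | no _ = towards-u w′∈S w~w′
    ... | no _ | yes refl = Oriented-sym (towards-u w∈S (~-sym w~w′))
    ... | no w≢v | no w′≢v =
      Oriented-local (sym (updateAt-minimal _ _ p w≢v)) (sym (updateAt-minimal _ _ p w′≢v))
                     (sym (updateAt-minimal _ _ r w≢v)) (sym (updateAt-minimal _ _ r w′≢v))
                     (oriented (x∈p∧x≢y⇒x∈p-y w∈S w≢v) (x∈p∧x≢y⇒x∈p-y w′∈S w′≢v) w~w′)

  cycle-or-forest : ∀ S → Acc _⊂_ S → MonoCycle G c ⊎ Forest S
  cycle-or-forest S (acc smaller) with any? (λ v → (v ∈? S) ×-dec ¬? (two-neighbours? S v))
  ... | no ¬leaf with nonempty? S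
  ...   | yes (s , s∈S) = inj₁ (cycle-if-two-neighbours S
                            (λ v∈S → decidable-stable (two-neighbours? S _) (λ ¬two → ¬leaf (_ , v∈S , ¬two))) s∈S)
  ...   | no empty = inj₂ ((λ v → v) , (λ _ → 0) , λ u∈S _ _ → ⊥-elim (empty (_ , u∈S)))
  cycle-or-forest S (acc smaller) | yes (v , v∈S , ¬two)
    with cycle-or-forest (S - v) (smaller (x∈p⇒p-x⊂p v∈S))
  ... | inj₁ cycle = inj₁ cycle
  ... | inj₂ F with any? (neighbour? S v)
  ...   | yes (u , nbu) = inj₂ (attach u v∈S (λ {w} nbw →
                            decidable-stable (w ≟ u) (λ w≢u → ¬two (w , u , w≢u , nbw , nbu))) F)
  ...   | no none = inj₂ (attach v v∈S (λ nbw → ⊥-elim (none (_ , nbw))) F)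

  monoCycle-or-forest : MonoCycle G c ⊎ Σ (Fin (V G) → Fin (V G)) λ p → Σ (Fin (V G) → ℕ) λ r →
                          ∀ {u v} → u ~ v → Oriented p r u v
  monoCycle-or-forest with cycle-or-forest ⊤ (⊂-wellFounded ⊤)
  ... | inj₁ cycle = inj₁ cycle
  ... | inj₂ (p , r , oriented) = inj₂ (p , r , oriented ∈⊤ ∈⊤)

Forests : (G : Graph) → EdgeColouring G → Set
Forests G c = Σ (Bool → Fin (V G) → Fin (V G)) λ p → Σ (Bool → Fin (V G) → ℕ) λ r →
                ∀ {u v} → Adj G u v → Oriented (p (col c u v)) (r (col c u v)) u v

monoCycle-or-forests : (G : Graph) (c : EdgeColouring G) → MonoCycle G c ⊎ Forests G c
monoCycle-or-forests G c with ColourClass.monoCycle-or-forest G c true | ColourClass.monoCycle-or-forest G c false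
... | inj₁ cycle | _ = inj₁ cycle
... | inj₂ _ | inj₁ cycle = inj₁ cycle
... | inj₂ (p₁ , r₁ , o₁) | inj₂ (p₀ , r₀ , o₀) = inj₂ (p , r , oriented)
  where
  p : Bool → Fin (V G) → Fin (V G)
  p true = p₁
  p false = p₀
  r : Bool → Fin (V G) → ℕ
  r true = r₁
  r false = r₀
  oriented : ∀ {u v} → Adj G u v → Oriented (p (col c u v)) (r (col c u v)) u v
  oriented {u} {v} uv with col c u v in e
  ... | true = o₁ (uv , e)
  ... | false = o₀ (uv , e)

-- Two forests on n vertices have at most 2n − 2 edges

record EdgeList (G : Graph) (L : ℕ) : Set where
  field
    edge     : Fin L → Fin (V G) × Fin (V G)
    adjacent : ∀ k → uncurry (Adj G) (edge k)
    distinct : ∀ {k l} → edge k ≈ edge l → k ≡ l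

tag : ∀ {n} → Bool → Fin n → Fin (n + n)
tag {n} true i = i ↑ˡ n
tag {n} false i = n ↑ʳ i

tag-injective : ∀ {n} β β′ (i i′ : Fin n) → tag β i ≡ tag β′ i′ → β ≡ β′ × i ≡ i′
tag-injective {n} β β′ i i′ e =
  untag β β′ (trans (sym (splitAt-tag β i)) (trans (cong (splitAt n) e) (splitAt-tag β′ i′)))
  where
  side : Bool → Fin n → Fin n ⊎ Fin n
  side true = inj₁
  side false = inj₂
  splitAt-tag : ∀ β i → splitAt n (tag β i) ≡ side β i
  splitAt-tag true i = splitAt-↑ˡ n i n
  splitAt-tag false i = splitAt-↑ʳ n n i
  untag : ∀ β β′ {i i′} → side β i ≡ side β′ i′ → β ≡ β′ × i ≡ i′
  untag true true refl = refl , refl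
  untag false false refl = refl , refl
  untag true false ()
  untag false true ()

module EdgeCount {G : Graph} {L : ℕ} (edges : EdgeList G L) (c : EdgeColouring G)
                 (p : Bool → Fin (V G) → Fin (V G)) (r : Bool → Fin (V G) → ℕ)
                 (oriented : ∀ {u v} → Adj G u v → Oriented (p (col c u v)) (r (col c u v)) u v) where
  open EdgeList edges

  -- An edge is coded by its colour and its child endpoint; a vertex of minimal rank is never a child,
  -- so each colour leaves a code unused.
  code : Fin L → Fin (V G + V G)
  code k = tag (uncurry (col c) (edge k)) (child (oriented (adjacent k)))

  same-code-same-edge : ∀ {β β′ i j i′ j′} (o : Oriented (p β) (r β) i j)
                        (o′ : Oriented (p β′) (r β′) i′ j′) →
                        tag β (child o) ≡ tag β′ (child o′) → SameEdge i j i′ j′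
  same-code-same-edge {β} {β′} o o′ e with tag-injective β β′ _ _ e
  ... | refl , child≡ =
    SameEdge-trans (SameEdge-sym (child-edge o)) (subst (λ x → SameEdge x (p _ x) _ _) (sym child≡) (child-edge o′))

  code-injective : Injective _≡_ _≡_ code
  code-injective e = distinct (same-code-same-edge (oriented (adjacent _)) (oriented (adjacent _)) e)

  roots-not-coded : ∀ β {z} → (∀ x → r β z ≤ r β x) → ∀ k → code k ≢ tag β z
  roots-not-coded β {z} z-min k e = not-root (oriented (adjacent k)) e
    where
    not-root : ∀ {β′ i j} (o : Oriented (p β′) (r β′) i j) → tag β′ (child o) ≢ tag β z
    not-root {β′} o e with tag-injective β′ β (child o) z e
    ... | refl , child≡z =
      <⇒≱ (child-above-parent o) (subst (λ x → r β x ≤ r β (p β (child o))) (sym child≡z) (z-min _))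

  edge-bound : Fin (V G) → suc (suc L) ≤ V G + V G
  edge-bound x₀ = injective⇒≤ coded-injective
    where
    root : Bool → Fin (V G)
    root β = minimiser x₀ (r β) .proj₁
    coded : Fin (suc (suc L)) → Fin (V G + V G)
    coded zero = tag true (root true)
    coded (suc zero) = tag false (root false)
    coded (suc (suc k)) = code k
    root-not-coded : ∀ β k → code k ≢ tag β (root β)
    root-not-coded β = roots-not-coded β (minimiser x₀ (r β) .proj₂)
    coded-injective : Injective _≡_ _≡_ coded
    coded-injective {zero} {zero} _ = refl
    coded-injective {zero} {suc zero} e with () ← tag-injective true false _ _ e .proj₁
    coded-injective {zero} {suc (suc l)} e = ⊥-elim (root-not-coded true l (sym e))
    coded-injective {suc zero} {zero} e with () ← tag-injective false true _ _ e .proj₁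
    coded-injective {suc zero} {suc zero} _ = refl
    coded-injective {suc zero} {suc (suc l)} e = ⊥-elim (root-not-coded false l (sym e))
    coded-injective {suc (suc k)} {zero} e = ⊥-elim (root-not-coded true k e)
    coded-injective {suc (suc k)} {suc zero} e = ⊥-elim (root-not-coded false k e)
    coded-injective {suc (suc k)} {suc (suc l)} e = cong (λ k → suc (suc k)) (code-injective e)

edge-count⇒InRC : ∀ {G L} → EdgeList G L → suc L ≡ V G + V G → InRC G
edge-count⇒InRC {G} {L} edges count c with monoCycle-or-forests G c
... | inj₁ cycle = cycle
... | inj₂ (p , r , oriented) = ⊥-elim (1+n≰n (subst (suc (suc L) ≤_) (sym count)
                                          (EdgeCount.edge-bound edges c p r oriented (vertex count))))
  where
  vertex : ∀ {n} → suc L ≡ n + n → Fin n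
  vertex {suc n} _ = zero

-- The 1-extension

double-gap : ∀ {a b} → a < b → suc (2 * a) < 2 * b
double-gap {a} {b} a<b = subst (_≤ 2 * b) (*-suc 2 a) (*-monoʳ-≤ 2 a<b)

-- Ranks are doubled so that a new vertex fits strictly between any parent and child.
module Hang {n : ℕ} (p : Fin n → Fin n) (r : Fin n → ℕ) (t : Fin n) where

  parent⁺ : Fin (suc n) → Fin (suc n)
  parent⁺ zero = suc t
  parent⁺ (suc i) = suc (p i)

  rank⁺ : Fin (suc n) → ℕ
  rank⁺ zero = suc (2 * r t)
  rank⁺ (suc i) = 2 * r i

  hang-old : ∀ {i j} → Oriented p r i j → Oriented parent⁺ rank⁺ (suc i) (suc j)
  hang-old (to-parent refl lt) = to-parent refl (*-monoʳ-< 2 lt)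
  hang-old (from-child refl lt) = from-child refl (*-monoʳ-< 2 lt)

  hang-new : Oriented parent⁺ rank⁺ zero (suc t)
  hang-new = to-parent refl (n<1+n _)

  module Subdivide (u : Fin n) (u→t : p u ≡ t) (t<u : r t < r u) where

    parent⁺⁺ : Fin (suc n) → Fin (suc n)
    parent⁺⁺ = updateAt parent⁺ (suc u) (λ _ → zero)

    subdivide-old : ∀ {i j} → Oriented p r i j → ¬ SameEdge i j u t → Oriented parent⁺⁺ rank⁺ (suc i) (suc j)
    subdivide-old {i} (to-parent refl lt) ¬ut =
      to-parent (updateAt-minimal (suc i) (suc u) parent⁺
                  (λ { refl → ¬ut (subst (SameEdge u (p u) u) u→t same) }))
                (*-monoʳ-< 2 lt)
    subdivide-old {j = j} (from-child refl lt) ¬ut =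
      from-child (updateAt-minimal (suc j) (suc u) parent⁺
                   (λ { refl → ¬ut (subst (SameEdge (p u) u u) u→t swapped) }))
                 (*-monoʳ-< 2 lt)

    subdivide-top : Oriented parent⁺⁺ rank⁺ zero (suc t)
    subdivide-top = to-parent refl (n<1+n _)

    subdivide-bottom : Oriented parent⁺⁺ rank⁺ zero (suc u)
    subdivide-bottom = from-child (updateAt-updates (suc u) parent⁺) (double-gap t<u)

deleteEdge : (G : Graph) → Fin (V G) → Fin (V G) → Graph
deleteEdge G a b = record
  { V = V G
  ; E = λ i j → E G i j ∧ not (does (same-edge? i j a b))
  ; sym = λ i j → cong₂ (λ e s → e ∧ not s) (Graph.sym G i j)
                   (does-⇔ (mk⇔ SameEdge-flip SameEdge-flip) (same-edge? i j a b) (same-edge? j i a b))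
  ; irrefl = λ i → cong (_∧ _) (irrefl G i)
  }

module _ {G : Graph} {a b : Fin (V G)} where

  deleteEdge-adj⁻ : ∀ {i j} → Adj (deleteEdge G a b) i j → Adj G i j × ¬ SameEdge i j a b
  deleteEdge-adj⁻ {i} {j} e =
    ∧-conicalˡ _ _ e , does-false⇒¬ (same-edge? i j a b) (not-injective (∧-conicalʳ _ _ e))

  deleteEdge-adj⁺ : ∀ {i j} → Adj G i j → ¬ SameEdge i j a b → Adj (deleteEdge G a b) i j
  deleteEdge-adj⁺ {i} {j} ij ¬ab rewrite ij | dec-false (same-edge? i j a b) ¬ab = refl

addVertex : (G : Graph) → (Fin (V G) → Bool) → Graph
addVertex G N = record { V = suc (V G) ; E = E′ ; sym = sym′ ; irrefl = irrefl′ }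
  where
  E′ : Fin (suc (V G)) → Fin (suc (V G)) → Bool
  E′ zero zero = false
  E′ zero (suc j) = N j
  E′ (suc i) zero = N i
  E′ (suc i) (suc j) = E G i j
  sym′ : ∀ i j → E′ i j ≡ E′ j i
  sym′ zero zero = refl
  sym′ zero (suc j) = refl
  sym′ (suc i) zero = refl
  sym′ (suc i) (suc j) = Graph.sym G i j
  irrefl′ : ∀ i → E′ i i ≡ false
  irrefl′ zero = refl
  irrefl′ (suc i) = irrefl G i

Among : ∀ {n} → Fin n → Fin n → Fin n → Fin n → Set
Among a b z j = j ≡ a ⊎ j ≡ b ⊎ j ≡ z

among? : ∀ {n} (a b z j : Fin n) → Dec (Among a b z j)
among? a b z j = (j ≟ a) ⊎-dec (j ≟ b) ⊎-dec (j ≟ z)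

extension : (G : Graph) → Fin (V G) → Fin (V G) → Fin (V G) → Graph
extension G a b z = addVertex (deleteEdge G a b) (λ j → does (among? a b z j))

complete : ℕ → Graph
complete n = record
  { V = n
  ; E = λ i j → not (does (i ≟ j))
  ; sym = λ i j → cong not (does-⇔ (mk⇔ sym sym) (i ≟ j) (j ≟ i))
  ; irrefl = λ i → cong not (dec-true (i ≟ i) refl)
  }

Proper : ∀ {k} (G : Graph) → (Fin (V G) → Fin k) → Set
Proper G c = ∀ i j → Adj G i j → c i ≢ c j

ProperExcept : ∀ {k} (G : Graph) → (Fin (V G) → Fin k) → Fin (V G) → Fin (V G) → Set
ProperExcept G c x y = ∀ {i j} → Adj G i j → ¬ SameEdge i j x y → c i ≢ c j

Clique : ∀ {k} (G : Graph) → (Fin k → Fin (V G)) → Set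
Clique G κ = ∀ p q → p ≢ q → Adj G (κ p) (κ q)

clique-bound : ∀ {G k} {κ : Fin k → Fin (V G)} → Clique G κ → ∀ j → Colourable G j → k ≤ j
clique-bound {κ = κ} clique j (c , proper) = injective⇒≤ {f = c ∘ κ}
  λ {p} {q} e → decidable-stable (p ≟ q) (λ p≢q → proper _ _ (clique p q p≢q) e)

module Extension (G : Graph) (a b z : Fin (V G)) where

  G⁺ : Graph
  G⁺ = extension G a b z

  new-edge : ∀ {k} → Adj G⁺ zero (suc k) → Among a b z k
  new-edge = does-true⇒ (among? a b z _)

  new-edge⁺ : ∀ {k} → Among a b z k → Adj G⁺ zero (suc k)
  new-edge⁺ = dec-true (among? a b z _)

  old-edge : ∀ {i j} → Adj G⁺ (suc i) (suc j) → Adj G i j × ¬ SameEdge i j a b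
  old-edge = deleteEdge-adj⁻ {G} {a} {b}

  old-edge⁺ : ∀ {i j} → Adj G i j → ¬ SameEdge i j a b → Adj G⁺ (suc i) (suc j)
  old-edge⁺ = deleteEdge-adj⁺ {G} {a} {b}

  extendColouring : EdgeColouring G → (Fin (V G) → Bool) → EdgeColouring G⁺
  extendColouring c κ = record { col = col′ ; colSym = colSym′ }
    where
    col′ : Fin (suc (V G)) → Fin (suc (V G)) → Bool
    col′ zero zero = false
    col′ zero (suc k) = κ k
    col′ (suc k) zero = κ k
    col′ (suc i) (suc j) = col c i j
    colSym′ : ∀ i j → col′ i j ≡ col′ j i
    colSym′ zero zero = refl
    colSym′ zero (suc k) = refl
    colSym′ (suc k) zero = refl
    colSym′ (suc i) (suc j) = colSym c i j

  build : ∀ {x y} (c : EdgeColouring G) (κ : Fin (V G) → Bool)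
          (p : Bool → Fin (suc (V G)) → Fin (suc (V G))) (r : Bool → Fin (suc (V G)) → ℕ) →
          (∀ {k} → Among a b z k → ¬ SameEdge zero (suc k) x y → Oriented (p (κ k)) (r (κ k)) zero (suc k)) →
          (∀ {i j} → Adj G i j → ¬ SameEdge i j a b → ¬ SameEdge (suc i) (suc j) x y →
             Oriented (p (col c i j)) (r (col c i j)) (suc i) (suc j)) →
          TwoForests G⁺ x y
  build c κ p r new old = record { colouring = extendColouring c κ ; parent = p ; rank = r ; oriented = oriented }
    where
    oriented : ∀ {i j} → Adj G⁺ i j → ¬ SameEdge i j _ _ →
               Oriented (p (col (extendColouring c κ) i j)) (r (col (extendColouring c κ) i j)) i j
    oriented {zero} {suc k} 0k ¬xy = new (new-edge 0k) ¬xy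
    oriented {suc k} {zero} k0 ¬xy = Oriented-sym (new (new-edge k0) (¬xy ∘ SameEdge-flip))
    oriented {suc i} {suc j} ij ¬xy = let ij′ , ¬ab = old-edge ij in old ij′ ¬ab ¬xy

  split-new-edge : TwoForests G a b → ∀ {t₁ t₂ j} → t₁ ≢ t₂ →
                   (∀ {k} → Among a b z k → k ≢ j → k ≡ t₁ ⊎ k ≡ t₂) → TwoForests G⁺ zero (suc j)
  split-new-edge F {t₁} {t₂} t₁≢t₂ cover = build colouring κ p r new old
    where
    open TwoForests F
    κ : Fin (V G) → Bool
    κ k = does (k ≟ t₁)
    end : Bool → Fin (V G)
    end true = t₁
    end false = t₂
    p : Bool → Fin (suc (V G)) → Fin (suc (V G))
    p γ = Hang.parent⁺ (parent γ) (rank γ) (end γ)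
    r : Bool → Fin (suc (V G)) → ℕ
    r γ = Hang.rank⁺ (parent γ) (rank γ) (end γ)
    end-κ : ∀ {k} → k ≡ t₁ ⊎ k ≡ t₂ → end (κ k) ≡ k
    end-κ (inj₁ refl) rewrite dec-true (t₁ ≟ t₁) refl = refl
    end-κ (inj₂ refl) rewrite dec-false (t₂ ≟ t₁) (t₁≢t₂ ∘ sym) = refl
    new : ∀ {k} → Among a b z k → ¬ SameEdge zero (suc k) zero (suc _) → Oriented (p (κ k)) (r (κ k)) zero (suc k)
    new {k} among ¬0j = subst (λ t → Oriented (p (κ k)) (r (κ k)) zero (suc t))
                              (end-κ (cover among (λ { refl → ¬0j same })))
                              (Hang.hang-new (parent (κ k)) (rank (κ k)) (end (κ k)))
    old : ∀ {i j} → Adj G i j → ¬ SameEdge i j a b → _ →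
          Oriented (p (col colouring i j)) (r (col colouring i j)) (suc i) (suc j)
    old ij ¬ab _ = Hang.hang-old _ _ _ (oriented ij ¬ab)

  module _ {x y} (F : TwoForests G x y) (ab : Adj G a b) (¬xy : ¬ SameEdge a b x y)
           (a≢z : a ≢ z) (b≢z : b ≢ z) where
    open TwoForests F

    -- In the colour of ab the new vertex subdivides ab; in the other colour it hangs from z.
    subdivide-old-edge : col colouring a b ≡ true → TwoForests G⁺ (suc x) (suc y)
    subdivide-old-edge ab-true = build colouring κ p r new old
      where
      o : Oriented (parent true) (rank true) a b
      o = subst (λ γ → Oriented (parent γ) (rank γ) a b) ab-true (oriented ab ¬xy)
      u t : Fin (V G)
      u = child o
      t = parent true u
      module H₁ = Hang (parent true) (rank true) t
      module S₁ = H₁.Subdivide u refl (child-above-parent o)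
      module H₀ = Hang (parent false) (rank false) z
      κ : Fin (V G) → Bool
      κ k = not (does (k ≟ z))
      p : Bool → Fin (suc (V G)) → Fin (suc (V G))
      p true = S₁.parent⁺⁺
      p false = H₀.parent⁺
      r : Bool → Fin (suc (V G)) → ℕ
      r true = H₁.rank⁺
      r false = H₀.rank⁺
      ut≈ab : SameEdge u t a b
      ut≈ab = child-edge o
      subdivided : ∀ {k} → k ≡ u ⊎ k ≡ t → Oriented (p true) (r true) zero (suc k)
      subdivided (inj₁ refl) = S₁.subdivide-bottom
      subdivided (inj₂ refl) = S₁.subdivide-top
      new : ∀ {k} → Among a b z k → _ → Oriented (p (κ k)) (r (κ k)) zero (suc k)
      new {k} (inj₂ (inj₂ refl)) _ rewrite dec-true (k ≟ k) refl = H₀.hang-new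
      new {k} (inj₁ refl) _ rewrite dec-false (k ≟ z) a≢z = subdivided (SameEdge-endpoint ut≈ab (inj₁ refl))
      new {k} (inj₂ (inj₁ refl)) _ rewrite dec-false (k ≟ z) b≢z = subdivided (SameEdge-endpoint ut≈ab (inj₂ refl))
      old : ∀ {i j} → Adj G i j → ¬ SameEdge i j a b → ¬ SameEdge (suc i) (suc j) (suc x) (suc y) →
            Oriented (p (col colouring i j)) (r (col colouring i j)) (suc i) (suc j)
      old {i} {j} ij ¬ab ¬xy⁺ with col colouring i j | oriented ij (¬xy⁺ ∘ SameEdge-map suc)
      ... | true | oij = S₁.subdivide-old oij (λ ij≈ut → ¬ab (SameEdge-trans ij≈ut ut≈ab))
      ... | false | oij = H₀.hang-old oij

  split-old-edge : ∀ {x y} → TwoForests G x y → Adj G a b → ¬ SameEdge a b x y → a ≢ z → b ≢ z →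
                   TwoForests G⁺ (suc x) (suc y)
  split-old-edge F ab ¬xy a≢z b≢z with TwoForests.colouring F .col a b in ab-colour
  ... | true = subdivide-old-edge F ab ¬xy a≢z b≢z ab-colour
  ... | false = subdivide-old-edge (swap-colours F) ab ¬xy a≢z b≢z (cong not ab-colour)

  extension-splittings : (∀ {x y} → Adj G x y → TwoForests G x y) → Adj G a b → a ≢ z → b ≢ z →
                         ∀ {x y} → Adj G⁺ x y → TwoForests G⁺ x y
  extension-splittings split ab a≢z b≢z {zero} {suc j} 0j with new-edge {j} 0j
  ... | inj₁ refl = split-new-edge (split ab) b≢z λ where
          (inj₁ k≡a) k≢j → ⊥-elim (k≢j k≡a) ; (inj₂ k∈bz) _ → k∈bz
  ... | inj₂ (inj₁ refl) = split-new-edge (split ab) a≢z λ where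
          (inj₁ k≡a) _ → inj₁ k≡a ; (inj₂ (inj₁ k≡b)) k≢j → ⊥-elim (k≢j k≡b) ; (inj₂ (inj₂ k≡z)) _ → inj₂ k≡z
  ... | inj₂ (inj₂ refl) = split-new-edge (split ab) (adj⇒≢ G ab) λ where
          (inj₁ k≡a) _ → inj₁ k≡a ; (inj₂ (inj₁ k≡b)) _ → inj₂ k≡b ; (inj₂ (inj₂ k≡z)) k≢j → ⊥-elim (k≢j k≡z)
  extension-splittings split ab a≢z b≢z {suc i} {zero} i0 =
    TwoForests-respects swapped (extension-splittings split ab a≢z b≢z {zero} {suc i} i0)
  extension-splittings split ab a≢z b≢z {suc x} {suc y} xy =
    let xy′ , ¬ab = old-edge xy
    in split-old-edge (split xy′) ab (¬ab ∘ SameEdge-sym) a≢z b≢z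

  extension-no-isolated : NoIsolatedVertex G → NoIsolatedVertex G⁺
  extension-no-isolated no-isolated zero = suc a , new-edge⁺ (inj₁ refl)
  extension-no-isolated no-isolated (suc i) with among? a b z i
  ... | yes i∈abz = zero , new-edge⁺ i∈abz
  ... | no i∉abz = let y , iy = no-isolated i in
    suc y , old-edge⁺ iy λ e →
      i∉abz ([ (λ (i≡a , _) → inj₁ i≡a) , (λ (i≡b , _) → inj₂ (inj₁ i≡b)) ] (endpoints e))

  lift : ∀ {i j} → Dec (SameEdge i j a b) → Fin (suc (V G)) × Fin (suc (V G))
  lift (yes _) = zero , suc a
  lift {i} {j} (no _) = suc i , suc j

  lift-adjacent : ∀ {i j} → Adj G i j → (d : Dec (SameEdge i j a b)) → uncurry (Adj G⁺) (lift d)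
  lift-adjacent ij (yes _) = new-edge⁺ (inj₁ refl)
  lift-adjacent ij (no ¬ab) = old-edge⁺ ij ¬ab

  lift-injective : ∀ {i j i′ j′} (d : Dec (SameEdge i j a b)) (d′ : Dec (SameEdge i′ j′ a b)) →
                   lift d ≈ lift d′ → SameEdge i j i′ j′
  lift-injective (yes ij≈ab) (yes i′j′≈ab) _ = SameEdge-trans ij≈ab (SameEdge-sym i′j′≈ab)
  lift-injective (no _) (no _) same = same
  lift-injective (no _) (no _) swapped = swapped

  lift-not-new : ∀ {i j t} → t ≢ a → (d : Dec (SameEdge i j a b)) → ¬ lift d ≈ (zero , suc t)
  lift-not-new t≢a (yes _) same = t≢a refl

  extension-edges : ∀ {L} → EdgeList G L → a ≢ b → b ≢ z → a ≢ z → EdgeList G⁺ (suc (suc L))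
  extension-edges {L} edges a≢b b≢z a≢z = record { edge = edge⁺ ; adjacent = adjacent⁺ ; distinct = distinct⁺ }
    where
    open EdgeList edges
    kept : ∀ k → Dec (edge k ≈ (a , b))
    kept k = edge k ≈? (a , b)
    edge⁺ : Fin (suc (suc L)) → Fin (suc (V G)) × Fin (suc (V G))
    edge⁺ zero = zero , suc b
    edge⁺ (suc zero) = zero , suc z
    edge⁺ (suc (suc k)) = lift (kept k)
    adjacent⁺ : ∀ k → uncurry (Adj G⁺) (edge⁺ k)
    adjacent⁺ zero = new-edge⁺ (inj₂ (inj₁ refl))
    adjacent⁺ (suc zero) = new-edge⁺ (inj₂ (inj₂ refl))
    adjacent⁺ (suc (suc k)) = lift-adjacent (adjacent k) (kept k)
    distinct⁺ : ∀ {k l} → edge⁺ k ≈ edge⁺ l → k ≡ l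
    distinct⁺ {zero} {zero} _ = refl
    distinct⁺ {zero} {suc zero} same = ⊥-elim (b≢z refl)
    distinct⁺ {zero} {suc (suc l)} e = ⊥-elim (lift-not-new (a≢b ∘ sym) (kept l) (SameEdge-sym e))
    distinct⁺ {suc zero} {zero} same = ⊥-elim (b≢z refl)
    distinct⁺ {suc zero} {suc zero} _ = refl
    distinct⁺ {suc zero} {suc (suc l)} e = ⊥-elim (lift-not-new (a≢z ∘ sym) (kept l) (SameEdge-sym e))
    distinct⁺ {suc (suc k)} {zero} e = ⊥-elim (lift-not-new (a≢b ∘ sym) (kept k) e)
    distinct⁺ {suc (suc k)} {suc zero} e = ⊥-elim (lift-not-new (a≢z ∘ sym) (kept k) e)
    distinct⁺ {suc (suc k)} {suc (suc l)} e = cong (λ k → suc (suc k)) (distinct (lift-injective (kept k) (kept l) e))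

  extension-clique : ∀ {k} {κ : Fin k → Fin (V G)} → Clique G κ → (∀ p → κ p ≢ a) → Clique G⁺ (λ p → suc (κ p))
  extension-clique clique avoids-a p q p≢q = old-edge⁺ (clique p q p≢q)
    λ e → [ (λ (κp≡a , _) → avoids-a p κp≡a) , (λ (_ , κq≡a) → avoids-a q κq≡a) ] (endpoints e)

  colour⁺ : ∀ {k} → (Fin (V G) → Fin k) → Fin k → Fin (suc (V G)) → Fin k
  colour⁺ c γ zero = γ
  colour⁺ c γ (suc i) = c i

  -- The new vertex may share its colour with b, since the edge from it to b is deleted next.
  extension-colouring : ∀ {k} {c : Fin (V G) → Fin k} {γ} → ProperExcept G c a b → γ ≢ c a → γ ≢ c z →
                        ProperExcept G⁺ (colour⁺ c γ) zero (suc b)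
  extension-colouring {c = c} {γ} proper γ≢ca γ≢cz = proper⁺
    where
    new : ∀ {j} → Among a b z j → j ≢ b → γ ≢ c j
    new (inj₁ refl) _ = γ≢ca
    new (inj₂ (inj₁ refl)) j≢b = ⊥-elim (j≢b refl)
    new (inj₂ (inj₂ refl)) _ = γ≢cz
    proper⁺ : ProperExcept G⁺ (colour⁺ c γ) zero (suc b)
    proper⁺ {zero} {suc j} 0j ¬0b = new (new-edge 0j) (λ { refl → ¬0b same })
    proper⁺ {suc j} {zero} j0 ¬0b = new (new-edge j0) (λ { refl → ¬0b swapped }) ∘ sym
    proper⁺ {suc i} {suc j} ij _ = let ij′ , ¬ab = old-edge ij in proper ij′ ¬ab

  extension-colouring-proper : ∀ {k} {c : Fin (V G) → Fin k} {γ} → ProperExcept G⁺ (colour⁺ c γ) zero (suc b) →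
                               γ ≢ c b → Proper G⁺ (colour⁺ c γ)
  extension-colouring-proper {c = c} {γ} proper γ≢cb i j ij with same-edge? i j zero (suc b)
  ... | yes same = γ≢cb
  ... | yes swapped = γ≢cb ∘ sym
  ... | no ¬0b = proper ij ¬0b

record Critical (G : Graph) : Set where
  field
    size        : ℕ
    edges       : EdgeList G size
    size≡       : suc size ≡ V G + V G
    no-isolated : NoIsolatedVertex G
    splittings  : ∀ {x y} → Adj G x y → TwoForests G x y

critical⇒InMC : ∀ {G} → Critical G → InMC G
critical⇒InMC C = edge-count⇒InRC edges size≡ , proper-subgraphs-not-in-RC splittings no-isolated
  where open Critical C

critical-extension : ∀ {G a b z} → Critical G → Adj G a b → a ≢ z → b ≢ z → Critical (extension G a b z)
critical-extension {G} {a} {b} {z} C ab a≢z b≢z = record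
  { size = suc (suc size)
  ; edges = extension-edges edges (adj⇒≢ G ab) b≢z a≢z
  ; size≡ = trans (cong (λ n → suc (suc n)) size≡) (sym (cong suc (+-suc (V G) (V G))))
  ; no-isolated = extension-no-isolated no-isolated
  ; splittings = extension-splittings splittings ab a≢z b≢z
  }
  where
  open Critical C
  open Extension G a b z

-- One step of the family performs two 1-extensions: the first new vertex is adjacent to a, b, z₁,
-- the second to the first, b and z₂, and the edge between the first new vertex and b is deleted again.
record Seed (k : ℕ) : Set where
  field
    graph           : Graph
    critical        : Critical graph
    clique          : Fin k → Fin (V graph)
    is-clique       : Clique graph clique
    colour          : Fin (V graph) → Fin k
    proper          : Proper graph colour
    a b z₁ z₂       : Fin (V graph)
    ab              : Adj graph a b
    a≢z₁            : a ≢ z₁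
    b≢z₂            : b ≢ z₂
    z₁≁b            : colour z₁ ≢ colour b
    z₂≁a            : colour z₂ ≢ colour a
    clique-avoids-a : ∀ p → clique p ≢ a

step : ∀ {k} → Seed k → Seed k
step {k} s = record
  { graph = E₂.G⁺
  ; critical = critical-extension (critical-extension critical ab a≢z₁ b≢z₁) (E₁.new-edge⁺ (inj₂ (inj₁ refl)))
                                  (λ ()) (b≢z₂ ∘ suc-injective)
  ; clique = λ p → suc (suc (clique p))
  ; is-clique = E₂.extension-clique {κ = λ p → suc (clique p)}
                 (E₁.extension-clique is-clique clique-avoids-a) (λ _ ())
  ; colour = colour₂
  ; proper = E₂.extension-colouring-proper
               (E₂.extension-colouring (E₁.extension-colouring (λ ij _ → proper _ _ ij) (ca≢cb ∘ sym) (z₁≁b ∘ sym))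
                                       ca≢cb (z₂≁a ∘ sym))
               ca≢cb
  ; a = zero ; b = suc (suc b) ; z₁ = suc (suc z₁) ; z₂ = suc (suc z₂)
  ; ab = E₂.new-edge⁺ (inj₂ (inj₁ refl))
  ; a≢z₁ = λ ()
  ; b≢z₂ = b≢z₂ ∘ suc-injective ∘ suc-injective
  ; z₁≁b = z₁≁b
  ; z₂≁a = z₂≁a
  ; clique-avoids-a = λ _ ()
  }
  where
  open Seed s
  module E₁ = Extension graph a b z₁
  module E₂ = Extension E₁.G⁺ zero (suc b) (suc z₂)
  colour₂ : Fin (suc (suc (V graph))) → Fin k
  colour₂ = E₂.colour⁺ (E₁.colour⁺ colour (colour b)) (colour a)
  b≢z₁ : b ≢ z₁
  b≢z₁ b≡z₁ = z₁≁b (cong colour (sym b≡z₁))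
  ca≢cb : colour a ≢ colour b
  ca≢cb = proper a b ab

family : ∀ {k} → Seed k → ℕ → Seed k
family s zero = s
family s (suc n) = step (family s n)

family-order : ∀ {k} (s : Seed k) n → V (Seed.graph (family s n)) ≡ 2 * n + V (Seed.graph s)
family-order s zero = refl
family-order s (suc n) =
  trans (cong (λ m → suc (suc m)) (family-order s n)) (cong (_+ V (Seed.graph s)) (sym (*-suc 2 n)))

iso⇒same-order : ∀ {G H} → Iso G H → V G ≡ V H
iso⇒same-order I =
  cantor-schröder-bernstein (Injection.injective (↔.↔⇒↣ bij)) (Injection.injective (↔.↔⇒↣ (↔.sym bij)))
  where open Iso I

ChromaticFamily : ℕ → Set
ChromaticFamily k = Σ (ℕ → Graph) λ G →
  (∀ n → InMC (G n) × ChromaticNumber (G n) k) × (∀ m n → m ≢ n → ¬ Iso (G m) (G n))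

seed⇒family : ∀ {k} → Seed k → ChromaticFamily k
seed⇒family s = (λ n → Seed.graph (family s n)) , members , non-isomorphic
  where
  members : ∀ n → _
  members n = critical⇒InMC critical , ((colour , proper) , clique-bound {graph} is-clique)
    where open Seed (family s n)
  non-isomorphic : ∀ m n → m ≢ n → ¬ Iso _ _
  non-isomorphic m n m≢n I = m≢n (*-cancelˡ-≡ m n 2 (+-cancelʳ-≡ _ (2 * m) (2 * n)
    (trans (sym (family-order s m)) (trans (iso⇒same-order I) (family-order s n)))))

SeedConditions : ∀ {k} (G : Graph) → (Fin k → Fin (V G)) → (Fin (V G) → Fin k) →
                 (a b z₁ z₂ : Fin (V G)) → Set
SeedConditions G κ c a b z₁ z₂ =
  Clique G κ × Proper G c × Adj G a b × a ≢ z₁ × b ≢ z₂ × c z₁ ≢ c b × c z₂ ≢ c a × (∀ p → κ p ≢ a)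

seed-conditions? : ∀ {k} G κ c a b z₁ z₂ → Dec (SeedConditions {k} G κ c a b z₁ z₂)
seed-conditions? G κ c a b z₁ z₂ =
  (all? λ p → all? λ q → ¬? (p ≟ q) →-dec adj? G (κ p) (κ q)) ×-dec
  (all? λ i → all? λ j → adj? G i j →-dec ¬? (c i ≟ c j)) ×-dec
  adj? G a b ×-dec ¬? (a ≟ z₁) ×-dec ¬? (b ≟ z₂) ×-dec ¬? (c z₁ ≟ c b) ×-dec ¬? (c z₂ ≟ c a) ×-dec
  (all? λ p → ¬? (κ p ≟ a))

CriticalGraph : Set
CriticalGraph = Σ Graph Critical

extend : (G : CriticalGraph) (a b z : Fin (V (proj₁ G))) →
         {_ : True (adj? (proj₁ G) a b ×-dec ¬? (a ≟ z) ×-dec ¬? (b ≟ z))} → CriticalGraph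
extend (G , C) a b z {ok} =
  let ab , a≢z , b≢z = toWitness ok in extension G a b z , critical-extension C ab a≢z b≢z

concrete-seed : ∀ {k} (G : CriticalGraph) (κ : Vec (Fin (V (proj₁ G))) k) (c : Vec (Fin k) (V (proj₁ G)))
                (a b z₁ z₂ : Fin (V (proj₁ G))) →
                {_ : True (seed-conditions? (proj₁ G) (lookup κ) (lookup c) a b z₁ z₂)} → Seed k
concrete-seed (G , critical) κ c a b z₁ z₂ {ok} =
  let is-clique , proper , ab , a≢z₁ , b≢z₂ , z₁≁b , z₂≁a , avoids = toWitness ok
  in record { graph = G ; critical = critical ; clique = lookup κ ; is-clique = is-clique
            ; colour = lookup c ; proper = proper ; a = a ; b = b ; z₁ = z₁ ; z₂ = z₂ ; ab = ab
            ; a≢z₁ = a≢z₁ ; b≢z₂ = b≢z₂ ; z₁≁b = z₁≁b ; z₂≁a = z₂≁a ; clique-avoids-a = avoids }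

K₅⁻ : Graph
K₅⁻ = deleteEdge (complete 5) (# 1) (# 3)

K₅⁻-edge : Fin 9 → Fin 5 × Fin 5
K₅⁻-edge = lookup ((# 0 , # 1) ∷ (# 0 , # 2) ∷ (# 0 , # 3) ∷ (# 0 , # 4) ∷ (# 1 , # 2) ∷
                   (# 1 , # 4) ∷ (# 2 , # 3) ∷ (# 2 , # 4) ∷ (# 3 , # 4) ∷ [])

-- For the k-th edge, the parent maps of two spanning trees rooted at 0 (a fixed point)
-- that together cover the other eight edges.
K₅⁻-trees : Vec (Vec (Fin 5) 5 × Vec (Fin 5) 5) 9
K₅⁻-trees =
  ((# 0 ∷ # 2 ∷ # 0 ∷ # 2 ∷ # 0 ∷ []) , (# 0 ∷ # 4 ∷ # 4 ∷ # 0 ∷ # 3 ∷ [])) ∷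
  ((# 0 ∷ # 0 ∷ # 1 ∷ # 2 ∷ # 0 ∷ []) , (# 0 ∷ # 4 ∷ # 4 ∷ # 0 ∷ # 3 ∷ [])) ∷
  ((# 0 ∷ # 0 ∷ # 1 ∷ # 2 ∷ # 0 ∷ []) , (# 0 ∷ # 4 ∷ # 0 ∷ # 4 ∷ # 2 ∷ [])) ∷
  ((# 0 ∷ # 0 ∷ # 0 ∷ # 2 ∷ # 1 ∷ []) , (# 0 ∷ # 2 ∷ # 4 ∷ # 0 ∷ # 3 ∷ [])) ∷
  ((# 0 ∷ # 0 ∷ # 0 ∷ # 2 ∷ # 0 ∷ []) , (# 0 ∷ # 4 ∷ # 4 ∷ # 0 ∷ # 3 ∷ [])) ∷
  ((# 0 ∷ # 0 ∷ # 0 ∷ # 2 ∷ # 0 ∷ []) , (# 0 ∷ # 2 ∷ # 4 ∷ # 0 ∷ # 3 ∷ [])) ∷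
  ((# 0 ∷ # 0 ∷ # 1 ∷ # 0 ∷ # 0 ∷ []) , (# 0 ∷ # 4 ∷ # 0 ∷ # 4 ∷ # 2 ∷ [])) ∷
  ((# 0 ∷ # 0 ∷ # 1 ∷ # 0 ∷ # 0 ∷ []) , (# 0 ∷ # 4 ∷ # 0 ∷ # 2 ∷ # 3 ∷ [])) ∷
  ((# 0 ∷ # 0 ∷ # 1 ∷ # 0 ∷ # 0 ∷ []) , (# 0 ∷ # 4 ∷ # 0 ∷ # 2 ∷ # 2 ∷ [])) ∷ []

depth : ∀ {n} → (Fin n → Fin n) → ℕ → Fin n → ℕ
depth p zero v = 0
depth p (suc fuel) v with p v ≟ v
... | yes _ = 0
... | no _ = suc (depth p fuel (p v))

K₅⁻-parent : Fin 9 → Bool → Fin 5 → Fin 5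
K₅⁻-parent k true = lookup (proj₁ (lookup K₅⁻-trees k))
K₅⁻-parent k false = lookup (proj₂ (lookup K₅⁻-trees k))

K₅⁻-rank : Fin 9 → Bool → Fin 5 → ℕ
K₅⁻-rank k β = depth (K₅⁻-parent k β) 5

K₅⁻-colouring : Fin 9 → EdgeColouring K₅⁻
K₅⁻-colouring k = record
  { col = λ i j → does (K₅⁻-parent k true i ≟ j) ∨ does (K₅⁻-parent k true j ≟ i)
  ; colSym = λ i j → ∨-comm (does (K₅⁻-parent k true i ≟ j)) (does (K₅⁻-parent k true j ≟ i))
  }

K₅⁻-splitting : ∀ k → uncurry (TwoForests K₅⁻) (K₅⁻-edge k)
K₅⁻-splitting k = record
  { colouring = K₅⁻-colouring k ; parent = K₅⁻-parent k ; rank = K₅⁻-rank k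
  ; oriented = λ {i} {j} → from-yes (all? λ k → all? λ i → all? λ j → let γ = col (K₅⁻-colouring k) i j in
      adj? K₅⁻ i j →-dec (¬? ((i , j) ≈? K₅⁻-edge k) →-dec oriented? (K₅⁻-parent k γ) (K₅⁻-rank k γ) i j)) k i j
  }

K₅⁻-critical : CriticalGraph
K₅⁻-critical = K₅⁻ , record
  { size = 9
  ; edges = record
      { edge = K₅⁻-edge
      ; adjacent = from-yes (all? λ k → uncurry (adj? K₅⁻) (K₅⁻-edge k))
      ; distinct = λ {k} {l} → from-yes (all? λ k → all? λ l → K₅⁻-edge k ≈? K₅⁻-edge l →-dec (k ≟ l)) k l
      }
  ; size≡ = refl
  ; no-isolated = from-yes (all? λ u → any? (adj? K₅⁻ u))
  ; splittings = λ {x} {y} xy →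
      let k , xy≈k = from-yes (all? λ x → all? λ y → adj? K₅⁻ x y →-dec any? λ k → (x , y) ≈? K₅⁻-edge k)
                              x y xy
      in TwoForests-respects xy≈k (K₅⁻-splitting k)
  }

K₄,₄⁻-critical : CriticalGraph
K₄,₄⁻-critical = extend (extend (extend K₅⁻-critical (# 0) (# 1) (# 3)) (# 1) (# 4) (# 2)) (# 4) (# 6) (# 0)

seed₂ : Seed 2
seed₂ = concrete-seed K₄,₄⁻-critical (# 1 ∷ # 3 ∷ []) (# 0 ∷ # 1 ∷ # 1 ∷ # 0 ∷ # 0 ∷ # 1 ∷ # 0 ∷ # 1 ∷ [])
                      (# 0) (# 1) (# 3) (# 2)

seed₃ : Seed 3
seed₃ = concrete-seed (extend K₅⁻-critical (# 0) (# 2) (# 1))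
                      (# 1 ∷ # 2 ∷ # 5 ∷ []) (# 0 ∷ # 1 ∷ # 2 ∷ # 1 ∷ # 2 ∷ # 0 ∷ []) (# 0) (# 1) (# 2) (# 2)

seed₄ : Seed 4
seed₄ = concrete-seed K₅⁻-critical (# 0 ∷ # 2 ∷ # 3 ∷ # 4 ∷ []) (# 0 ∷ # 1 ∷ # 2 ∷ # 1 ∷ # 3 ∷ [])
                      (# 1) (# 2) (# 0) (# 0)

corollary1p6 : (k : ℕ) → 2 ≤ k → k ≤ 4 →
    Σ (ℕ → Graph) λ G →
      (∀ n → InMC (G n) × ChromaticNumber (G n) k) ×
      (∀ m n → m ≢ n → ¬ Iso (G m) (G n))
corollary1p6 1 (s≤s ()) _
corollary1p6 2 _ _ = seed⇒family seed₂
corollary1p6 3 _ _ = seed⇒family seed₃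
corollary1p6 4 _ _ = seed⇒family seed₄
corollary1p6 (suc (suc (suc (suc (suc _))))) _ (s≤s (s≤s (s≤s (s≤s ()))))
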